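{- Let $G$ be a finite simple graph (undirected, no loops, no multiple edges) with $E$ edges, and let $p$ be a prime with $p \geq 3$. Then the number $C_p(G)$ of cycles of length $p$ in $G$ satisfies $C_p(G) \leq \frac{2^{p/2-1}}{p} E^{p/2}$.
   Context: A cycle of length $k$ in $G$ is a subgraph of $G$ isomorphic to the cycle graph on $k$ vertices. -}

module Defs where

open import Data.Nat using (ℕ; zero; suc; _+_; _<_; _<ᵇ_)
open import Data.Bool using (Bool; true; false; if_then_else_; _∧_)
open import Data.Fin using (Fin; toℕ)
open import Data.Vec using (Vec; lookup)
open import Data.List using (List; map; allFin; concatMap)
open import Data.Nat.ListAction using (sum)
open import Data.Product using (_×_; _,_; Σ; ∃)
open import Data.Sum using (_⊎_)
open import Relation.Binary.PropositionalEquality using (_≡_)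
open import Function.Bundles using (_⇔_)
open import Function.Definitions using (Injective)

record Graph : Set where
  field
    n      : ℕ
    adj    : Fin n → Fin n → Bool
    sym    : ∀ i j → adj i j ≡ adj j i
    irrefl : ∀ i → adj i i ≡ false
open Graph public

numEdges : Graph → ℕ
numEdges G =
  sum (concatMap (λ i → map (λ j → if (toℕ i <ᵇ toℕ j) ∧ adj G i j then 1 else 0)
                            (allFin (n G)))
                 (allFin (n G)))

-- Raw data of a (candidate) subgraph of G: a vertex set W and an edge
-- set F, both given as Boolean vectors (concrete data, decidable equality).
SubgraphData : Graph → Set
SubgraphData G = Vec Bool (n G) × Vec (Vec Bool (n G)) (n G)

inW : (G : Graph) → SubgraphData G → Fin (n G) → Bool
inW G (W , F) v = lookup W v

inF : (G : Graph) → SubgraphData G → Fin (n G) → Fin (n G) → Bool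
inF G (W , F) i j = lookup (lookup F i) j

IsSubgraph : (G : Graph) → SubgraphData G → Set
IsSubgraph G H =
  (∀ i j → inF G H i j ≡ inF G H j i) ×
  (∀ i j → inF G H i j ≡ true →
     (adj G i j ≡ true) × (inW G H i ≡ true) × (inW G H j ≡ true))

CycSucc : (k : ℕ) → Fin k → Fin k → Set
CycSucc k a b = (toℕ b ≡ suc (toℕ a)) ⊎ ((suc (toℕ a) ≡ k) × (toℕ b ≡ 0))

CycleAdj : (k : ℕ) → Fin k → Fin k → Set
CycleAdj k a b = CycSucc k a b ⊎ CycSucc k b a

IsoToCycle : (G : Graph) → (k : ℕ) → SubgraphData G → Set
IsoToCycle G k H =
  Σ (Fin k → Fin (n G)) λ f →
    Injective _≡_ _≡_ f ×
    (∀ v → (inW G H v ≡ true) ⇔ (∃ λ a → f a ≡ v)) ×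
    (∀ a b → (inF G H (f a) (f b) ≡ true) ⇔ CycleAdj k a b)

IsCycleOfLength : (G : Graph) → (k : ℕ) → SubgraphData G → Set
IsCycleOfLength G k H = IsSubgraph G H × IsoToCycle G k H

{-# OPTIONS --safe #-}
module Submission where

-- Let A be the 0/1 adjacency matrix of G, so that ‖A‖² = ∑ᵤ∑ᵥ A(u,v)² = 2E.
-- A p-cycle H with a bijection f : C_p → H gives the 2p closed walks f ∘ σ,
-- σ a rotation or reflection of C_p; they are pairwise distinct, and a closed
-- walk determines the cycle it runs around, so 2p·C_p(G) ≤ tr(A^p).
-- Cauchy–Schwarz gives ‖A^(k+1)‖² ≤ ‖A‖²·‖A^k‖² for the Frobenius norm and
-- tr(A^p)² ≤ ‖A‖²·‖A^(p-1)‖², hence (2p·C_p(G))² ≤ ‖A‖^(2p) = (2E)^p.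

open import Data.Bool using (Bool; true; false; T; if_then_else_; _∧_)
open import Data.Bool.Properties using (⇔→≡; T-≡)
open import Data.Empty using (⊥-elim)
open import Data.Fin using (Fin; zero; suc; toℕ; fromℕ; inject₁; opposite)
open import Data.Fin.Permutation
  using (Permutation′; permutation; _⟨$⟩ʳ_; _⟨$⟩ˡ_; inverseˡ; inverseʳ; _∘ₚ_; reverse)
import Data.Fin.Permutation as Permutation
open import Data.Fin.Properties using (toℕ-injective; toℕ-fromℕ; toℕ-inject₁; toℕ<n; opposite-involutive)
open import Data.List using (List; []; _∷_; _++_; [_]; map; concatMap; cartesianProduct; length; allFin)
open import Data.List.Membership.Propositional using (_∈_; lose; find)
open import Data.List.Membership.Propositional.Properties
  using (∈-∃++; ∈-concatMap⁺; ∈-map⁺; ∈-map⁻; ∈-++⁻; ∈-allFin)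
open import Data.List.Properties using (map-cong; map-∘; map-++; length-++; length-map; length-tabulate)
open import Data.List.Relation.Binary.Disjoint.Propositional using (Disjoint)
open import Data.List.Relation.Binary.Permutation.Propositional using (_↭_; ↭-sym)
import Data.List.Relation.Binary.Permutation.Propositional.Properties as ↭
open import Data.List.Relation.Binary.Subset.Propositional using (_⊆_)
open import Data.List.Relation.Unary.All as All using (All; []; _∷_)
open import Data.List.Relation.Unary.Any using (Any; here; there; satisfied)
open import Data.List.Relation.Unary.Unique.Propositional using (Unique; []; _∷_)
import Data.List.Relation.Unary.Unique.Propositional.Properties as Unique
open import Data.Nat
open import Data.Nat.ListAction using (sum)
open import Data.Nat.ListAction.Properties using (sum-++; sum-↭)
open import Data.Nat.Primality using (Prime)
open import Data.Nat.Properties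
open import Data.Nat.Tactic.RingSolver using (solve-∀)
open import Data.Product using (_×_; _,_; proj₁; proj₂; uncurry; ∃)
open import Data.Sum using (_⊎_; inj₁; inj₂; [_,_]′; swap)
open import Data.Sum.Function.Propositional using (_⊎-⇔_)
open import Data.Vec using (Vec; []; _∷_; lookup; tabulate)
open import Data.Vec.Properties using (tabulate∘lookup; lookup∘tabulate; tabulate-cong)
open import Defs hiding (sym; n)
open import Function using (_∘_; id)
open import Function.Bundles using (_⇔_; mk⇔; Equivalence)
open import Function.Construct.Composition using (_⇔-∘_)
open import Function.Construct.Symmetry using (⇔-sym)
open import Function.Definitions using (Injective)
open import Relation.Binary.PropositionalEquality
  using (_≡_; _≗_; refl; sym; trans; cong; cong₂; subst; subst₂; module ≡-Reasoning)
open import Relation.Nullary using (¬_; contradiction; yes; no)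

open import Algebra.Properties.CommutativeSemigroup +-commutativeSemigroup
  using () renaming (interchange to +-interchange)
open import Algebra.Properties.CommutativeSemigroup *-commutativeSemigroup
  using () renaming (interchange to *-interchange)

open Equivalence using (to; from)

private
  variable
    A B : Set
    n k : ℕ

-- Finite sums over lists

∑ : List A → (A → ℕ) → ℕ
∑ xs f = sum (map f xs)

syntax ∑ xs (λ x → e) = ∑[ x ← xs ] e

∑-cong : (xs : List A) {f g : A → ℕ} → (∀ x → f x ≡ g x) → ∑ xs f ≡ ∑ xs g
∑-cong xs f≗g = cong sum (map-cong f≗g xs)

∑-mono-≤ : (xs : List A) {f g : A → ℕ} → (∀ x → f x ≤ g x) → ∑ xs f ≤ ∑ xs g
∑-mono-≤ []       f≤g = z≤n
∑-mono-≤ (x ∷ xs) f≤g = +-mono-≤ (f≤g x) (∑-mono-≤ xs f≤g)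

∑-distrib-+ : (xs : List A) (f g : A → ℕ) → ∑[ x ← xs ] (f x + g x) ≡ ∑ xs f + ∑ xs g
∑-distrib-+ []       f g = refl
∑-distrib-+ (x ∷ xs) f g = begin
  f x + g x + ∑[ y ← xs ] (f y + g y) ≡⟨ cong (f x + g x +_) (∑-distrib-+ xs f g) ⟩
  f x + g x + (∑ xs f + ∑ xs g)       ≡⟨ +-interchange (f x) (g x) _ _ ⟩
  f x + ∑ xs f + (g x + ∑ xs g)       ∎
  where open ≡-Reasoning

*-distribˡ-∑ : (c : ℕ) (xs : List A) (f : A → ℕ) → c * ∑ xs f ≡ ∑[ x ← xs ] (c * f x)
*-distribˡ-∑ c []       f = *-zeroʳ c
*-distribˡ-∑ c (x ∷ xs) f =
  trans (*-distribˡ-+ c (f x) (∑ xs f)) (cong (c * f x +_) (*-distribˡ-∑ c xs f))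

*-distribʳ-∑ : (c : ℕ) (xs : List A) (f : A → ℕ) → ∑ xs f * c ≡ ∑[ x ← xs ] (f x * c)
*-distribʳ-∑ c xs f = begin
  ∑ xs f * c            ≡⟨ *-comm (∑ xs f) c ⟩
  c * ∑ xs f            ≡⟨ *-distribˡ-∑ c xs f ⟩
  ∑[ x ← xs ] (c * f x) ≡⟨ ∑-cong xs (λ x → *-comm c (f x)) ⟩
  ∑[ x ← xs ] (f x * c) ∎
  where open ≡-Reasoning

∑-++ : (xs ys : List A) (f : A → ℕ) → ∑ (xs ++ ys) f ≡ ∑ xs f + ∑ ys f
∑-++ xs ys f = trans (cong sum (map-++ f xs ys)) (sum-++ (map f xs) (map f ys))

∑-map : (xs : List A) (g : A → B) (f : B → ℕ) → ∑ (map g xs) f ≡ ∑ xs (f ∘ g)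
∑-map xs g f = cong sum (sym (map-∘ xs))

sum-concatMap : (xs : List A) (g : A → List ℕ) → sum (concatMap g xs) ≡ ∑[ x ← xs ] sum (g x)
sum-concatMap []       g = refl
sum-concatMap (x ∷ xs) g =
  trans (sum-++ (g x) (concatMap g xs)) (cong (sum (g x) +_) (sum-concatMap xs g))

∑-concatMap : (xs : List A) (g : A → List B) (f : B → ℕ) →
  ∑ (concatMap g xs) f ≡ ∑[ x ← xs ] ∑ (g x) f
∑-concatMap []       g f = refl
∑-concatMap (x ∷ xs) g f =
  trans (∑-++ (g x) (concatMap g xs) f) (cong (∑ (g x) f +_) (∑-concatMap xs g f))

∑-cartesianProduct : (xs : List A) (ys : List B) (f : A × B → ℕ) →
  ∑ (cartesianProduct xs ys) f ≡ ∑[ x ← xs ] ∑[ y ← ys ] f (x , y)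
∑-cartesianProduct []       ys f = refl
∑-cartesianProduct (x ∷ xs) ys f = begin
  ∑ (map (x ,_) ys ++ cartesianProduct xs ys) f
    ≡⟨ ∑-++ (map (x ,_) ys) _ f ⟩
  ∑ (map (x ,_) ys) f + ∑ (cartesianProduct xs ys) f
    ≡⟨ cong₂ _+_ (∑-map ys (x ,_) f) (∑-cartesianProduct xs ys f) ⟩
  ∑[ y ← ys ] f (x , y) + ∑[ x′ ← xs ] ∑[ y ← ys ] f (x′ , y) ∎
  where open ≡-Reasoning

length-cartesianProduct : (xs : List A) (ys : List B) →
  length (cartesianProduct xs ys) ≡ length xs * length ys
length-cartesianProduct []       ys = refl
length-cartesianProduct (x ∷ xs) ys = begin
  length (map (x ,_) ys ++ cartesianProduct xs ys)
    ≡⟨ length-++ (map (x ,_) ys) ⟩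
  length (map (x ,_) ys) + length (cartesianProduct xs ys)
    ≡⟨ cong₂ _+_ (length-map (x ,_) ys) (length-cartesianProduct xs ys) ⟩
  length ys + length xs * length ys ∎
  where open ≡-Reasoning

∑-comm : (xs : List A) (ys : List B) (f : A → B → ℕ) →
  ∑[ x ← xs ] ∑[ y ← ys ] f x y ≡ ∑[ y ← ys ] ∑[ x ← xs ] f x y
∑-comm []       ys f = sym (∑-zero ys)
  where
  ∑-zero : (ys : List B) → ∑[ y ← ys ] 0 ≡ 0
  ∑-zero []       = refl
  ∑-zero (_ ∷ ys) = ∑-zero ys
∑-comm (x ∷ xs) ys f = begin
  ∑[ y ← ys ] f x y + ∑[ x′ ← xs ] ∑[ y ← ys ] f x′ y ≡⟨ cong (∑[ y ← ys ] f x y +_) (∑-comm xs ys f) ⟩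
  ∑[ y ← ys ] f x y + ∑[ y ← ys ] ∑[ x′ ← xs ] f x′ y ≡⟨ ∑-distrib-+ ys (f x) _ ⟨
  ∑[ y ← ys ] (f x y + ∑[ x′ ← xs ] f x′ y)           ∎
  where open ≡-Reasoning

∑-mono-⊆ : {xs ys : List A} (f : A → ℕ) → Unique xs → xs ⊆ ys → ∑ xs f ≤ ∑ ys f
∑-mono-⊆ f [] _ = z≤n
∑-mono-⊆ {xs = x ∷ xs} f (x∉xs ∷ xs-unique) xs⊆ys
  with ys₁ , ys₂ , refl ← ∈-∃++ (xs⊆ys (here refl)) = begin
    f x + ∑ xs f                ≤⟨ +-monoʳ-≤ (f x) (∑-mono-⊆ f xs-unique xs⊆ys₁++ys₂) ⟩
    f x + ∑ (ys₁ ++ ys₂) f      ≡⟨ sum-↭ (↭.map⁺ f (↭-sym shift)) ⟩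
    ∑ (ys₁ ++ [ x ] ++ ys₂) f   ∎
  where
  open ≤-Reasoning
  shift : ys₁ ++ [ x ] ++ ys₂ ↭ x ∷ ys₁ ++ ys₂
  shift = ↭.shift x ys₁ ys₂
  xs⊆ys₁++ys₂ : xs ⊆ ys₁ ++ ys₂
  xs⊆ys₁++ys₂ z∈xs with ↭.∈-resp-↭ shift (xs⊆ys (there z∈xs))
  ... | here refl   = contradiction refl (All.lookup x∉xs z∈xs)
  ... | there z∈ys′ = z∈ys′

length≤∑ : (xs : List A) (f : A → ℕ) → (∀ {x} → x ∈ xs → 1 ≤ f x) → length xs ≤ ∑ xs f
length≤∑ []       f pos = z≤n
length≤∑ (x ∷ xs) f pos = +-mono-≤ (pos (here refl)) (length≤∑ xs f (pos ∘ there))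

-- Cauchy–Schwarz over ℕ

*-self-cancel-≤ : ∀ {m n} → m * m ≤ n * n → m ≤ n
*-self-cancel-≤ {m} {n} m²≤n² with m ≤? n
... | yes m≤n = m≤n
... | no  m≰n = contradiction m²≤n² (<⇒≱ (*-mono-< (≰⇒> m≰n) (≰⇒> m≰n)))

4xy≤[x+y]² : ∀ x y → 4 * (x * y) ≤ (x + y) * (x + y)
4xy≤[x+y]² x y = [ ordered , flipped ]′ (≤-total x y)
  where
  ordered : ∀ {x y} → x ≤ y → 4 * (x * y) ≤ (x + y) * (x + y)
  ordered {x} x≤y with d , refl ← m≤n⇒∃[o]m+o≡n x≤y =
    subst (4 * (x * (x + d)) ≤_) (expand x d) (m≤m+n _ (d * d))
    where
    expand : ∀ x d → 4 * (x * (x + d)) + d * d ≡ (x + (x + d)) * (x + (x + d))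
    expand = solve-∀
  flipped : y ≤ x → 4 * (x * y) ≤ (x + y) * (x + y)
  flipped y≤x = subst₂ _≤_ (cong (4 *_) (*-comm y x)) (cong (λ s → s * s) (+-comm y x)) (ordered y≤x)

cauchy-schwarz-step : ∀ a b s A B → s * s ≤ A * B →
  (a * b + s) * (a * b + s) ≤ (a * a + A) * (b * b + B)
cauchy-schwarz-step a b s A B s²≤AB = begin
  (a * b + s) * (a * b + s)                         ≡⟨ expand-left a b s ⟩
  a * a * (b * b) + 2 * (a * b * s) + s * s         ≤⟨ +-mono-≤ (+-monoʳ-≤ (a * a * (b * b)) cross) s²≤AB ⟩
  a * a * (b * b) + (a * a * B + b * b * A) + A * B ≡⟨ expand-right a b A B ⟩
  (a * a + A) * (b * b + B)                         ∎
  where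
  open ≤-Reasoning
  expand-left : ∀ a b s → (a * b + s) * (a * b + s) ≡ a * a * (b * b) + 2 * (a * b * s) + s * s
  expand-left = solve-∀
  expand-right : ∀ a b A B →
    a * a * (b * b) + (a * a * B + b * b * A) + A * B ≡ (a * a + A) * (b * b + B)
  expand-right = solve-∀
  regroup₁ : ∀ a b s → 2 * (a * b * s) * (2 * (a * b * s)) ≡ 4 * (a * a * (b * b)) * (s * s)
  regroup₁ = solve-∀
  regroup₂ : ∀ a b A B → 4 * (a * a * (b * b)) * (A * B) ≡ 4 * (a * a * B * (b * b * A))
  regroup₂ = solve-∀
  cross : 2 * (a * b * s) ≤ a * a * B + b * b * A
  cross = *-self-cancel-≤ (begin
    2 * (a * b * s) * (2 * (a * b * s))               ≡⟨ regroup₁ a b s ⟩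
    4 * (a * a * (b * b)) * (s * s)                   ≤⟨ *-monoʳ-≤ (4 * (a * a * (b * b))) s²≤AB ⟩
    4 * (a * a * (b * b)) * (A * B)                   ≡⟨ regroup₂ a b A B ⟩
    4 * (a * a * B * (b * b * A))                     ≤⟨ 4xy≤[x+y]² (a * a * B) (b * b * A) ⟩
    (a * a * B + b * b * A) * (a * a * B + b * b * A) ∎)

cauchy-schwarz : (xs : List A) (f g : A → ℕ) →
  ∑[ x ← xs ] (f x * g x) * ∑[ x ← xs ] (f x * g x) ≤
  ∑[ x ← xs ] (f x * f x) * ∑[ x ← xs ] (g x * g x)
cauchy-schwarz []       f g = z≤n
cauchy-schwarz (x ∷ xs) f g = cauchy-schwarz-step (f x) (g x) _ _ _ (cauchy-schwarz xs f g)

cauchy-schwarz₂ : (xs : List A) (ys : List B) (f g : A → B → ℕ) →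
  ∑[ x ← xs ] ∑[ y ← ys ] (f x y * g x y) * ∑[ x ← xs ] ∑[ y ← ys ] (f x y * g x y) ≤
  ∑[ x ← xs ] ∑[ y ← ys ] (f x y * f x y) * ∑[ x ← xs ] ∑[ y ← ys ] (g x y * g x y)
cauchy-schwarz₂ xs ys f g =
  subst₂ _≤_ (cong (λ t → t * t) (pairs (λ x y → f x y * g x y)))
             (cong₂ _*_ (pairs (λ x y → f x y * f x y)) (pairs (λ x y → g x y * g x y)))
             (cauchy-schwarz (cartesianProduct xs ys) (uncurry f) (uncurry g))
  where
  pairs : (h : _ → _ → ℕ) → ∑ (cartesianProduct xs ys) (uncurry h) ≡ ∑[ x ← xs ] ∑[ y ← ys ] h x y
  pairs h = ∑-cartesianProduct xs ys (uncurry h)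

-- The cycle graph C_(n+1) and its rotations and reflections

⟨$⟩ʳ-injective : (π : Permutation′ k) {a b : Fin k} → π ⟨$⟩ʳ a ≡ π ⟨$⟩ʳ b → a ≡ b
⟨$⟩ʳ-injective π {a} {b} eq = begin
  a                       ≡⟨ inverseˡ π ⟨
  π ⟨$⟩ˡ (π ⟨$⟩ʳ a)       ≡⟨ cong (π ⟨$⟩ˡ_) eq ⟩
  π ⟨$⟩ˡ (π ⟨$⟩ʳ b)       ≡⟨ inverseˡ π ⟩
  b                       ∎
  where open ≡-Reasoning


prev : Fin (suc n) → Fin (suc n)
prev zero    = fromℕ _
prev (suc i) = inject₁ i

cycSucc-prev : (c : Fin (suc n)) → CycSucc (suc n) (prev c) c
cycSucc-prev {n} zero    = inj₂ (cong suc (toℕ-fromℕ n) , refl)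
cycSucc-prev     (suc i) = inj₁ (cong suc (sym (toℕ-inject₁ i)))

cycSucc⇒≡prev : {a b : Fin (suc n)} → CycSucc (suc n) a b → a ≡ prev b
cycSucc⇒≡prev {b = suc i} (inj₁ b≡1+a) =
  toℕ-injective (trans (suc-injective (sym b≡1+a)) (sym (toℕ-inject₁ i)))
cycSucc⇒≡prev {n} {b = zero} (inj₂ (1+a≡1+n , _)) =
  toℕ-injective (trans (suc-injective 1+a≡1+n) (sym (toℕ-fromℕ n)))

cycSucc⇔≡prev : {a b : Fin (suc n)} → CycSucc (suc n) a b ⇔ a ≡ prev b
cycSucc⇔≡prev = mk⇔ cycSucc⇒≡prev (λ { refl → cycSucc-prev _ })

opposite-fromℕ : ∀ n → opposite (fromℕ n) ≡ zero
opposite-fromℕ zero    = refl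
opposite-fromℕ (suc n) = cong inject₁ (opposite-fromℕ n)

opposite-inject₁ : (i : Fin n) → opposite (inject₁ i) ≡ suc (opposite i)
opposite-inject₁ zero    = refl
opposite-inject₁ (suc i) = cong inject₁ (opposite-inject₁ i)

prev-opposite-prev : (c : Fin (suc n)) → prev (opposite (prev c)) ≡ opposite c
prev-opposite-prev {n} zero = cong prev (opposite-fromℕ n)
prev-opposite-prev (suc i)  = cong prev (opposite-inject₁ i)

-- Conjugating by the reflection c ↦ n - c turns the predecessor into the successor.
next : Fin (suc n) → Fin (suc n)
next c = opposite (prev (opposite c))

prev-next : (c : Fin (suc n)) → prev (next c) ≡ c
prev-next c = trans (prev-opposite-prev (opposite c)) (opposite-involutive c)

next-prev : (c : Fin (suc n)) → next (prev c) ≡ c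
next-prev c = trans (cong opposite (prev-opposite-prev c)) (opposite-involutive c)

opposite-prev : (c : Fin (suc n)) → opposite (prev c) ≡ next (opposite c)
opposite-prev c = cong (opposite ∘ prev) (sym (opposite-involutive c))

cycSucc-next : (c : Fin (suc n)) → CycSucc (suc n) c (next c)
cycSucc-next c = subst (λ a → CycSucc _ a (next c)) (prev-next c) (cycSucc-prev (next c))

toℕ-next : (c : Fin (suc n)) → suc (toℕ c) < suc n → toℕ (next c) ≡ suc (toℕ c)
toℕ-next c 1+c<1+n with cycSucc-next c
... | inj₁ next≡1+c      = next≡1+c
... | inj₂ (1+c≡1+n , _) = contradiction 1+c≡1+n (<⇒≢ 1+c<1+n)

nextₚ : Permutation′ (suc n)
nextₚ = permutation next prev next-prev prev-next

rotation : ℕ → Permutation′ (suc n)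
rotation zero    = Permutation.id
rotation (suc r) = rotation r ∘ₚ nextₚ

rotation-prev : ∀ r (c : Fin (suc n)) → rotation r ⟨$⟩ʳ prev c ≡ prev (rotation r ⟨$⟩ʳ c)
rotation-prev zero    c = refl
rotation-prev (suc r) c = begin
  next (rotation r ⟨$⟩ʳ prev c)        ≡⟨ cong next (rotation-prev r c) ⟩
  next (prev (rotation r ⟨$⟩ʳ c))      ≡⟨ next-prev _ ⟩
  rotation r ⟨$⟩ʳ c                    ≡⟨ prev-next _ ⟨
  prev (next (rotation r ⟨$⟩ʳ c))      ∎
  where open ≡-Reasoning

toℕ-rotation-zero : ∀ {r} → r ≤ n → toℕ (rotation {n} r ⟨$⟩ʳ zero) ≡ r
toℕ-rotation-zero {r = zero}  _   = refl
toℕ-rotation-zero {r = suc r} r<n = begin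
  toℕ (next (rotation r ⟨$⟩ʳ zero)) ≡⟨ toℕ-next _ (subst (λ x → suc x < _) (sym IH) (s≤s r<n)) ⟩
  suc (toℕ (rotation r ⟨$⟩ʳ zero))  ≡⟨ cong suc IH ⟩
  suc r                             ∎
  where
  open ≡-Reasoning
  IH : toℕ (rotation r ⟨$⟩ʳ zero) ≡ r
  IH = toℕ-rotation-zero (<⇒≤ r<n)

rotation-zero : (r : Fin (suc n)) → rotation (toℕ r) ⟨$⟩ʳ zero ≡ r
rotation-zero r = toℕ-injective (toℕ-rotation-zero (s≤s⁻¹ (toℕ<n r)))

IsCycleAutomorphism : (k : ℕ) → Permutation′ k → Set
IsCycleAutomorphism k π = ∀ a b → CycleAdj k (π ⟨$⟩ʳ a) (π ⟨$⟩ʳ b) ⇔ CycleAdj k a b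

commutes-prev⇒cycSucc⇔ : (π : Permutation′ (suc n)) → (∀ c → π ⟨$⟩ʳ prev c ≡ prev (π ⟨$⟩ʳ c)) →
  ∀ a b → CycSucc (suc n) (π ⟨$⟩ʳ a) (π ⟨$⟩ʳ b) ⇔ CycSucc (suc n) a b
commutes-prev⇒cycSucc⇔ π commutes a b = mk⇔ forward backward
  where
  forward : CycSucc _ (π ⟨$⟩ʳ a) (π ⟨$⟩ʳ b) → CycSucc _ a b
  forward πa→πb = from cycSucc⇔≡prev
    (⟨$⟩ʳ-injective π (trans (cycSucc⇒≡prev πa→πb) (sym (commutes b))))
  backward : CycSucc _ a b → CycSucc _ (π ⟨$⟩ʳ a) (π ⟨$⟩ʳ b)
  backward a→b with refl ← cycSucc⇒≡prev a→b =
    subst (λ x → CycSucc _ x (π ⟨$⟩ʳ b)) (sym (commutes b)) (cycSucc-prev (π ⟨$⟩ʳ b))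

reverses-prev⇒cycSucc⇔ : (π : Permutation′ (suc n)) → (∀ c → π ⟨$⟩ʳ prev c ≡ next (π ⟨$⟩ʳ c)) →
  ∀ a b → CycSucc (suc n) (π ⟨$⟩ʳ b) (π ⟨$⟩ʳ a) ⇔ CycSucc (suc n) a b
reverses-prev⇒cycSucc⇔ π reverses a b = mk⇔ forward backward
  where
  forward : CycSucc _ (π ⟨$⟩ʳ b) (π ⟨$⟩ʳ a) → CycSucc _ a b
  forward πb→πa = from cycSucc⇔≡prev (sym (⟨$⟩ʳ-injective π (begin
    π ⟨$⟩ʳ prev b               ≡⟨ reverses b ⟩
    next (π ⟨$⟩ʳ b)             ≡⟨ cong next (cycSucc⇒≡prev πb→πa) ⟩
    next (prev (π ⟨$⟩ʳ a))      ≡⟨ next-prev _ ⟩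
    π ⟨$⟩ʳ a                    ∎)))
    where open ≡-Reasoning
  backward : CycSucc _ a b → CycSucc _ (π ⟨$⟩ʳ b) (π ⟨$⟩ʳ a)
  backward a→b with refl ← cycSucc⇒≡prev a→b =
    subst (CycSucc _ (π ⟨$⟩ʳ b)) (sym (reverses b)) (cycSucc-next (π ⟨$⟩ʳ b))

rotation-isCycleAutomorphism : ∀ r → IsCycleAutomorphism (suc n) (rotation r)
rotation-isCycleAutomorphism r a b = succ⇔ a b ⊎-⇔ succ⇔ b a
  where
  succ⇔ : ∀ a b → CycSucc _ (rotation r ⟨$⟩ʳ a) (rotation r ⟨$⟩ʳ b) ⇔ CycSucc _ a b
  succ⇔ = commutes-prev⇒cycSucc⇔ (rotation r) (rotation-prev r)

reflection : ℕ → Permutation′ (suc n)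
reflection r = rotation r ∘ₚ reverse

reflection-prev : ∀ r (c : Fin (suc n)) → reflection r ⟨$⟩ʳ prev c ≡ next (reflection r ⟨$⟩ʳ c)
reflection-prev r c = trans (cong opposite (rotation-prev r c)) (opposite-prev (rotation r ⟨$⟩ʳ c))

reflection-isCycleAutomorphism : ∀ r → IsCycleAutomorphism (suc n) (reflection r)
reflection-isCycleAutomorphism r a b = mk⇔ swap swap ⇔-∘ (succ⇔ b a ⊎-⇔ succ⇔ a b)
  where
  succ⇔ : ∀ a b → CycSucc _ (reflection r ⟨$⟩ʳ b) (reflection r ⟨$⟩ʳ a) ⇔ CycSucc _ a b
  succ⇔ = reverses-prev⇒cycSucc⇔ (reflection r) (reflection-prev r)

cycSucc-asym : 3 ≤ k → {a b : Fin k} → CycSucc k a b → ¬ CycSucc k b a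
cycSucc-asym 3≤k = asym 3≤k
  where
  asym : ∀ {k x y} → 3 ≤ k → y ≡ suc x ⊎ (suc x ≡ k × y ≡ 0) → ¬ (x ≡ suc y ⊎ (suc y ≡ k × x ≡ 0))
  asym _                (inj₁ refl)          (inj₁ ())
  asym (s≤s (s≤s ()))   (inj₁ refl)          (inj₂ (refl , refl))
  asym (s≤s (s≤s ()))   (inj₂ (refl , refl)) (inj₁ refl)

rotation≢reflection : 3 ≤ suc n → ∀ r r′ → ¬ (∀ c → rotation {n} r ⟨$⟩ʳ c ≡ reflection r′ ⟨$⟩ʳ c)
rotation≢reflection 3≤k r r′ same =
  cycSucc-asym 3≤k ρ0→ρ1 (subst₂ (CycSucc _) (sym (same _)) (sym (same _)) σ1→σ0)
  where
  ρ0→ρ1 : CycSucc _ (rotation r ⟨$⟩ʳ zero) (rotation r ⟨$⟩ʳ next zero)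
  ρ0→ρ1 = from (commutes-prev⇒cycSucc⇔ (rotation r) (rotation-prev r) zero (next zero))
               (cycSucc-next zero)
  σ1→σ0 : CycSucc _ (reflection r′ ⟨$⟩ʳ next zero) (reflection r′ ⟨$⟩ʳ zero)
  σ1→σ0 = from (reverses-prev⇒cycSucc⇔ (reflection r′) (reflection-prev r′) zero (next zero))
               (cycSucc-next zero)

symmetry : Bool × Fin (suc n) → Permutation′ (suc n)
symmetry (false , r) = rotation (toℕ r)
symmetry (true  , r) = reflection (toℕ r)

symmetries : List (Bool × Fin (suc n))
symmetries = cartesianProduct (false ∷ true ∷ []) (allFin _)

symmetries-unique : Unique (symmetries {n})
symmetries-unique = Unique.cartesianProduct⁺ (((λ ()) ∷ []) ∷ [] ∷ []) (Unique.allFin⁺ _)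

length-symmetries : length (symmetries {n}) ≡ 2 * suc n
length-symmetries {n} = trans (length-cartesianProduct (false ∷ true ∷ []) (allFin (suc n)))
                              (cong (2 *_) (length-tabulate {n = suc n} id))

symmetry-isCycleAutomorphism : ∀ s → IsCycleAutomorphism (suc n) (symmetry s)
symmetry-isCycleAutomorphism (false , r) = rotation-isCycleAutomorphism (toℕ r)
symmetry-isCycleAutomorphism (true  , r) = reflection-isCycleAutomorphism (toℕ r)

symmetry-injective : 3 ≤ suc n → ∀ s t → (∀ c → symmetry s ⟨$⟩ʳ c ≡ symmetry t ⟨$⟩ʳ c) → s ≡ t
symmetry-injective _ (false , r) (false , r′) same =
  cong (false ,_) (trans (sym (rotation-zero r)) (trans (same zero) (rotation-zero r′)))
symmetry-injective _ (true , r) (true , r′) same =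
  cong (true ,_) (trans (sym (rotation-zero r)) (trans (⟨$⟩ʳ-injective reverse (same zero)) (rotation-zero r′)))
symmetry-injective 3≤k (false , r) (true , r′) same =
  ⊥-elim (rotation≢reflection 3≤k (toℕ r) (toℕ r′) same)
symmetry-injective 3≤k (true , r) (false , r′) same =
  ⊥-elim (rotation≢reflection 3≤k (toℕ r′) (toℕ r) (sym ∘ same))

-- Walks and the trace of matrix powers

module Walks {N : ℕ} (A : Fin N → Fin N → ℕ) where

  vertices : List (Fin N)
  vertices = allFin N

  tuples : (k : ℕ) → List (Vec (Fin N) k)
  tuples zero    = [ [] ]
  tuples (suc k) = concatMap (λ x → map (x ∷_) (tuples k)) vertices

  ∈-tuples : (xs : Vec (Fin N) k) → xs ∈ tuples k
  ∈-tuples []       = here refl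
  ∈-tuples (x ∷ xs) = ∈-concatMap⁺ _ (lose (∈-allFin x) (∈-map⁺ (x ∷_) (∈-tuples xs)))

  pathWeight : Fin N → Vec (Fin N) k → Fin N → ℕ
  pathWeight u []       v = A u v
  pathWeight u (x ∷ xs) v = A u x * pathWeight x xs v

  -- The (u , v) entry of A ^ (k + 1).
  walks : ℕ → Fin N → Fin N → ℕ
  walks k u v = ∑[ xs ← tuples k ] pathWeight u xs v

  walks-suc : ∀ k u v → walks (suc k) u v ≡ ∑[ x ← vertices ] (A u x * walks k x v)
  walks-suc k u v = begin
    ∑[ xs ← concatMap (λ x → map (x ∷_) (tuples k)) vertices ] pathWeight u xs v
      ≡⟨ ∑-concatMap vertices _ _ ⟩
    ∑[ x ← vertices ] ∑[ xs ← map (x ∷_) (tuples k) ] pathWeight u xs v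
      ≡⟨ ∑-cong vertices (λ x → ∑-map (tuples k) (x ∷_) _) ⟩
    ∑[ x ← vertices ] ∑[ xs ← tuples k ] (A u x * pathWeight x xs v)
      ≡⟨ ∑-cong vertices (λ x → *-distribˡ-∑ (A u x) (tuples k) _) ⟨
    ∑[ x ← vertices ] (A u x * walks k x v) ∎
    where open ≡-Reasoning

  ‖_‖² : (Fin N → Fin N → ℕ) → ℕ
  ‖ M ‖² = ∑[ u ← vertices ] ∑[ v ← vertices ] (M u v * M u v)

  ‖walks‖²≤ : ∀ k → ‖ walks k ‖² ≤ ‖ A ‖² ^ suc k
  ‖walks‖²≤ zero = ≤-reflexive (begin
    ‖ walks 0 ‖² ≡⟨ ∑-cong vertices (λ u → ∑-cong vertices (λ v → cong (λ a → a * a) (+-identityʳ (A u v)))) ⟩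
    ‖ A ‖²       ≡⟨ *-identityʳ ‖ A ‖² ⟨
    ‖ A ‖² * 1   ∎)
    where open ≡-Reasoning
  ‖walks‖²≤ (suc k) = begin
    ‖ walks (suc k) ‖²
      ≡⟨ ∑-cong vertices (λ u → ∑-cong vertices (λ v → cong₂ _*_ (walks-suc k u v) (walks-suc k u v))) ⟩
    ∑[ u ← vertices ] ∑[ v ← vertices ]
      (∑[ x ← vertices ] (A u x * W x v) * ∑[ x ← vertices ] (A u x * W x v))
      ≤⟨ ∑-mono-≤ vertices (λ u → ∑-mono-≤ vertices (λ v → cauchy-schwarz vertices (A u) (λ x → W x v))) ⟩
    ∑[ u ← vertices ] ∑[ v ← vertices ] (row u * column v)
      ≡⟨ ∑-cong vertices (λ u → *-distribˡ-∑ (row u) vertices column) ⟨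
    ∑[ u ← vertices ] (row u * ∑ vertices column)
      ≡⟨ *-distribʳ-∑ (∑ vertices column) vertices row ⟨
    ‖ A ‖² * ∑ vertices column
      ≡⟨ cong (‖ A ‖² *_) (∑-comm vertices vertices (λ x v → W x v * W x v)) ⟨
    ‖ A ‖² * ‖ W ‖²
      ≤⟨ *-monoʳ-≤ ‖ A ‖² (‖walks‖²≤ k) ⟩
    ‖ A ‖² ^ suc (suc k) ∎
    where
    open ≤-Reasoning
    W : Fin N → Fin N → ℕ
    W = walks k
    row : Fin N → ℕ
    row u = ∑[ x ← vertices ] (A u x * A u x)
    column : Fin N → ℕ
    column v = ∑[ x ← vertices ] (W x v * W x v)

  closedWeight : Vec (Fin N) (suc k) → ℕ
  closedWeight (u ∷ xs) = pathWeight u xs u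

  -- The trace of A ^ (k + 1).
  closedWalks : ℕ → ℕ
  closedWalks k = ∑[ w ← tuples (suc k) ] closedWeight w

  closedWalks≡trace : ∀ k → closedWalks k ≡ ∑[ u ← vertices ] walks k u u
  closedWalks≡trace k = trans (∑-concatMap vertices _ closedWeight)
                              (∑-cong vertices (λ u → ∑-map (tuples k) (u ∷_) closedWeight))

  closedWalks²≤ : ∀ k → closedWalks (suc k) * closedWalks (suc k) ≤ ‖ A ‖² ^ suc (suc k)
  closedWalks²≤ k = begin
    closedWalks (suc k) * closedWalks (suc k)
      ≡⟨ cong (λ t → t * t) (trans (closedWalks≡trace (suc k)) (∑-cong vertices (λ u → walks-suc k u u))) ⟩
    ∑[ u ← vertices ] ∑[ x ← vertices ] (A u x * W x u) *
    ∑[ u ← vertices ] ∑[ x ← vertices ] (A u x * W x u)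
      ≤⟨ cauchy-schwarz₂ vertices vertices A (λ u x → W x u) ⟩
    ‖ A ‖² * ∑[ u ← vertices ] ∑[ x ← vertices ] (W x u * W x u)
      ≡⟨ cong (‖ A ‖² *_) (∑-comm vertices vertices (λ x u → W x u * W x u)) ⟨
    ‖ A ‖² * ‖ W ‖²
      ≤⟨ *-monoʳ-≤ ‖ A ‖² (‖walks‖²≤ k) ⟩
    ‖ A ‖² ^ suc (suc k) ∎
    where
    open ≤-Reasoning
    W : Fin N → Fin N → ℕ
    W = walks k

  pathWeight-positive : ∀ u (xs : Vec (Fin N) k) v →
    (∀ i → 1 ≤ A (lookup (u ∷ xs) (inject₁ i)) (lookup xs i)) →
    1 ≤ A (lookup (u ∷ xs) (fromℕ k)) v →
    1 ≤ pathWeight u xs v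
  pathWeight-positive u []       v _     last = last
  pathWeight-positive u (x ∷ xs) v steps last =
    *-mono-≤ (steps zero) (pathWeight-positive x xs v (steps ∘ suc) last)

  closedWeight-positive : (w : Vec (Fin N) (suc k)) →
    (∀ c → 1 ≤ A (lookup w (prev c)) (lookup w c)) → 1 ≤ closedWeight w
  closedWeight-positive (u ∷ xs) steps = pathWeight-positive u xs u (steps ∘ suc) (steps zero)

-- The adjacency matrix of G

<ᵇ≡false⇒≮ : ∀ {m n} → (m <ᵇ n) ≡ false → ¬ m < n
<ᵇ≡false⇒≮ m≮n m<n = subst T m≮n (<⇒<ᵇ m<n)

indicator : Bool → ℕ
indicator b = if b then 1 else 0

indicator-square : ∀ b → indicator b * indicator b ≡ indicator b
indicator-square false = refl
indicator-square true  = refl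

module _ (G : Graph) where

  private
    N : ℕ
    N = Graph.n G

  adjacency : Fin N → Fin N → ℕ
  adjacency u v = indicator (adj G u v)

  edge : Fin N → Fin N → ℕ
  edge i j = indicator ((toℕ i <ᵇ toℕ j) ∧ adj G i j)

  adjacency²≡edge+edge : ∀ u x → adjacency u x * adjacency u x ≡ edge u x + edge x u
  adjacency²≡edge+edge u x with toℕ u <ᵇ toℕ x in u<x | toℕ x <ᵇ toℕ u in x<u
  ... | true  | true  =
    ⊥-elim (<-asym (<ᵇ⇒< (toℕ u) (toℕ x) (from T-≡ u<x)) (<ᵇ⇒< (toℕ x) (toℕ u) (from T-≡ x<u)))
  ... | true  | false = trans (indicator-square (adj G u x)) (sym (+-identityʳ _))
  ... | false | true  = trans (indicator-square (adj G u x)) (cong indicator (Graph.sym G u x))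
  ... | false | false
    with refl ← toℕ-injective {i = u} {x} (≤-antisym (≮⇒≥ (<ᵇ≡false⇒≮ x<u)) (≮⇒≥ (<ᵇ≡false⇒≮ u<x))) =
    cong (λ b → indicator b * indicator b) (irrefl G u)

  open Walks adjacency using (vertices; ‖_‖²)

  numEdges≡∑edge : numEdges G ≡ ∑[ i ← vertices ] ∑[ j ← vertices ] edge i j
  numEdges≡∑edge = sum-concatMap vertices (λ i → map (edge i) vertices)

  ‖adjacency‖²≡2E : ‖ adjacency ‖² ≡ 2 * numEdges G
  ‖adjacency‖²≡2E = begin
    ‖ adjacency ‖²
      ≡⟨ ∑-cong vertices (λ u → ∑-cong vertices (adjacency²≡edge+edge u)) ⟩
    ∑[ u ← vertices ] ∑[ x ← vertices ] (edge u x + edge x u)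
      ≡⟨ ∑-cong vertices (λ u → ∑-distrib-+ vertices (edge u) (λ x → edge x u)) ⟩
    ∑[ u ← vertices ] (∑[ x ← vertices ] edge u x + ∑[ x ← vertices ] edge x u)
      ≡⟨ ∑-distrib-+ vertices _ _ ⟩
    E + ∑[ u ← vertices ] ∑[ x ← vertices ] edge x u
      ≡⟨ cong (E +_) (∑-comm vertices vertices edge) ⟨
    E + E
      ≡⟨ cong (E +_) (+-identityʳ E) ⟨
    2 * E
      ≡⟨ cong (2 *_) numEdges≡∑edge ⟨
    2 * numEdges G ∎
    where
    open ≡-Reasoning
    E : ℕ
    E = ∑[ i ← vertices ] ∑[ j ← vertices ] edge i j

-- Cycles of G and the closed walks around them

lookup-ext : {xs ys : Vec A k} → (∀ i → lookup xs i ≡ lookup ys i) → xs ≡ ys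
lookup-ext {xs = xs} {ys} eq =
  trans (sym (tabulate∘lookup xs)) (trans (tabulate-cong eq) (tabulate∘lookup ys))

tabulate-injective : {f g : Fin k → A} → tabulate f ≡ tabulate g → f ≗ g
tabulate-injective {f = f} {g} eq i =
  trans (sym (lookup∘tabulate f i)) (trans (cong (λ w → lookup w i) eq) (lookup∘tabulate g i))

-- IsoToCycle G k H is Σ f (Parametrizes G k H f); it is a record so that H and f
-- can be inferred from a proof of it.
record Parametrizes (G : Graph) (k : ℕ) (H : SubgraphData G) (f : Fin k → Fin (Graph.n G)) : Set where
  field
    injective : Injective _≡_ _≡_ f
    image     : ∀ v → (inW G H v ≡ true) ⇔ (∃ λ a → f a ≡ v)
    edges     : ∀ a b → (inF G H (f a) (f b) ≡ true) ⇔ CycleAdj k a b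

open Parametrizes

isoToCycle⇒parametrizes : ∀ {G k H} ((f , _) : IsoToCycle G k H) → Parametrizes G k H f
isoToCycle⇒parametrizes (_ , injective , image , edges) =
  record { injective = injective ; image = image ; edges = edges }

module _ {G : Graph} {k : ℕ} where

  private
    Vertex : Set
    Vertex = Fin (Graph.n G)

  parametrizes-resp-≗ : ∀ {H} {f g : Fin k → Vertex} → f ≗ g →
    Parametrizes G k H f → Parametrizes G k H g
  parametrizes-resp-≗ {H} {f} {g} f≗g par = record
    { injective = λ {a} {b} ga≡gb → injective par (trans (f≗g a) (trans ga≡gb (sym (f≗g b))))
    ; image     = λ v → mk⇔
        (λ v∈W → let a , fa≡v = to (image par v) v∈W in a , trans (sym (f≗g a)) fa≡v)
        (λ (a , ga≡v) → from (image par v) (a , trans (f≗g a) ga≡v))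
    ; edges     = λ a b →
        subst₂ (λ x y → (inF G H x y ≡ true) ⇔ CycleAdj k a b) (f≗g a) (f≗g b) (edges par a b)
    }

  parametrizes-∘ : ∀ {H} {f : Fin k → Vertex} → Parametrizes G k H f →
    (π : Permutation′ k) → IsCycleAutomorphism k π → Parametrizes G k H (f ∘ (π ⟨$⟩ʳ_))
  parametrizes-∘ {f = f} par π π-automorphism = record
    { injective = ⟨$⟩ʳ-injective π ∘ injective par
    ; image     = λ v → mk⇔
        (λ v∈W → let a , fa≡v = to (image par v) v∈W in π ⟨$⟩ˡ a , trans (cong f (inverseʳ π)) fa≡v)
        (λ (a , fπa≡v) → from (image par v) (π ⟨$⟩ʳ a , fπa≡v))
    ; edges     = λ a b → π-automorphism a b ⇔-∘ edges par (π ⟨$⟩ʳ a) (π ⟨$⟩ʳ b)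
    }

  edges⊆ : ∀ {H H′ f} → IsSubgraph G H → Parametrizes G k H f → Parametrizes G k H′ f →
    ∀ {i j} → inF G H i j ≡ true → inF G H′ i j ≡ true
  edges⊆ (_ , F⊆E×W²) par par′ {i} {j} ij∈F
    with _ , i∈W , j∈W ← F⊆E×W² i j ij∈F
    with a , refl ← to (image par i) i∈W | b , refl ← to (image par j) j∈W =
    from (edges par′ a b) (to (edges par a b) ij∈F)

  parametrization-determines-cycle : ∀ {H H′ f} → IsSubgraph G H → IsSubgraph G H′ →
    Parametrizes G k H f → Parametrizes G k H′ f → H ≡ H′
  parametrization-determines-cycle sub sub′ par par′ = cong₂ _,_
    (lookup-ext (λ v → ⇔→≡ (⇔-sym (image par′ v) ⇔-∘ image par v)))
    (lookup-ext (λ i → lookup-ext (λ j → ⇔→≡ (mk⇔ (edges⊆ sub par par′) (edges⊆ sub′ par′ par)))))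

module _ (G : Graph) {n : ℕ} (3≤p : 3 ≤ suc n) where

  private
    p : ℕ
    p = suc n
    Vertex : Set
    Vertex = Fin (Graph.n G)

  open Walks (adjacency G)

  orbitWalk : (Fin p → Vertex) → Bool × Fin p → Vec Vertex p
  orbitWalk f s = tabulate (f ∘ (symmetry s ⟨$⟩ʳ_))

  orbit : (Fin p → Vertex) → List (Vec Vertex p)
  orbit f = map (orbitWalk f) symmetries

  length-orbit : ∀ f → length (orbit f) ≡ 2 * p
  length-orbit f = trans (length-map _ (symmetries {n})) length-symmetries

  orbit-unique : ∀ {f} → Injective _≡_ _≡_ f → Unique (orbit f)
  orbit-unique {f} f-injective = Unique.map⁺
    (λ {s} {t} eq → symmetry-injective 3≤p s t (f-injective ∘ tabulate-injective {f = f ∘ (symmetry s ⟨$⟩ʳ_)} eq))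
    symmetries-unique

  ∈-orbit : ∀ {H f w} → Parametrizes G p H f → w ∈ orbit f → Parametrizes G p H (lookup w)
  ∈-orbit {f = f} par w∈orbit with s , _ , refl ← ∈-map⁻ (orbitWalk f) {xs = symmetries} w∈orbit =
    parametrizes-resp-≗ (sym ∘ lookup∘tabulate _)
      (parametrizes-∘ par (symmetry s) (symmetry-isCycleAutomorphism s))

  Traverses : Vec Vertex p → SubgraphData G → Set
  Traverses w H = IsSubgraph G H × Parametrizes G p H (lookup w)

  traverses⇒closed : ∀ {w H} → Traverses w H → 1 ≤ closedWeight w
  traverses⇒closed {w} {H} (sub , par) = closedWeight-positive w step
    where
    step : ∀ c → 1 ≤ adjacency G (lookup w (prev c)) (lookup w c)
    step c = subst (λ b → 1 ≤ indicator b) (sym (proj₁ (proj₂ sub _ _ w-step∈H))) ≤-refl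
      where
      w-step∈H : inF G H (lookup w (prev c)) (lookup w c) ≡ true
      w-step∈H = from (edges par (prev c) c) (inj₁ (cycSucc-prev c))

  cycleWalks : ∀ {L} → All (IsCycleOfLength G p) L → List (Vec Vertex p)
  cycleWalks []                     = []
  cycleWalks ((_ , f , _) ∷ cycles) = orbit f ++ cycleWalks cycles

  ∈-cycleWalks : ∀ {L} (cycles : All (IsCycleOfLength G p) L) {w} →
    w ∈ cycleWalks cycles → Any (Traverses w) L
  ∈-cycleWalks ((sub , iso@(f , _)) ∷ cycles) w∈ with ∈-++⁻ (orbit f) w∈
  ... | inj₁ w∈orbit = here (sub , ∈-orbit (isoToCycle⇒parametrizes iso) w∈orbit)
  ... | inj₂ w∈rest  = there (∈-cycleWalks cycles w∈rest)

  cycleWalks-unique : ∀ {L} → Unique L → (cycles : All (IsCycleOfLength G p) L) →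
    Unique (cycleWalks cycles)
  cycleWalks-unique [] [] = []
  cycleWalks-unique (H∉L ∷ L-unique) ((sub , iso@(f , _)) ∷ cycles) =
    Unique.++⁺ (orbit-unique (injective par)) (cycleWalks-unique L-unique cycles) disjoint
    where
    par : Parametrizes G p _ f
    par = isoToCycle⇒parametrizes iso
    disjoint : Disjoint (orbit f) (cycleWalks cycles)
    disjoint (w∈orbit , w∈rest) with H′ , H′∈L , sub′ , par′ ← find (∈-cycleWalks cycles w∈rest) =
      All.lookup H∉L H′∈L (parametrization-determines-cycle sub sub′ (∈-orbit par w∈orbit) par′)

  length-cycleWalks : ∀ {L} (cycles : All (IsCycleOfLength G p) L) →
    length (cycleWalks cycles) ≡ length L * (2 * p)
  length-cycleWalks []                     = refl
  length-cycleWalks ((_ , f , _) ∷ cycles) =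
    trans (length-++ (orbit f)) (cong₂ _+_ (length-orbit f) (length-cycleWalks cycles))

  cycles≤closedWalks : ∀ {L} → Unique L → All (IsCycleOfLength G p) L →
    length L * (2 * p) ≤ closedWalks n
  cycles≤closedWalks {L} L-unique cycles = begin
    length L * (2 * p)                 ≡⟨ length-cycleWalks cycles ⟨
    length (cycleWalks cycles)         ≤⟨ length≤∑ _ closedWeight closed ⟩
    ∑ (cycleWalks cycles) closedWeight ≤⟨ ∑-mono-⊆ closedWeight (cycleWalks-unique L-unique cycles) (∈-tuples ∘ _) ⟩
    closedWalks n                      ∎
    where
    open ≤-Reasoning
    closed : ∀ {w} → w ∈ cycleWalks cycles → 1 ≤ closedWeight w
    closed {w} w∈ = let H , w-traverses-H = satisfied (∈-cycleWalks cycles w∈) in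
      traverses⇒closed {w} {H} w-traverses-H

^-distribʳ-* : ∀ m n k → (m * n) ^ k ≡ m ^ k * n ^ k
^-distribʳ-* m n zero    = refl
^-distribʳ-* m n (suc k) = trans (cong (m * n *_) (^-distribʳ-* m n k)) (*-interchange m n (m ^ k) (n ^ k))

halve-square-bound : ∀ x E q → (2 * x) * (2 * x) ≤ (2 * E) ^ (2 + q) → x ^ 2 ≤ 2 ^ q * E ^ (2 + q)
halve-square-bound x E q h = *-cancelˡ-≤ 4 (begin
  4 * x ^ 2                   ≡⟨ regroup₁ x ⟩
  (2 * x) * (2 * x)           ≤⟨ h ⟩
  (2 * E) ^ (2 + q)           ≡⟨ ^-distribʳ-* 2 E (2 + q) ⟩
  2 ^ (2 + q) * E ^ (2 + q)   ≡⟨ regroup₂ (2 ^ q) (E ^ (2 + q)) ⟩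
  4 * (2 ^ q * E ^ (2 + q))   ∎)
  where
  open ≤-Reasoning
  regroup₁ : ∀ x → 4 * (x * (x * 1)) ≡ (2 * x) * (2 * x)
  regroup₁ = solve-∀
  regroup₂ : ∀ a b → 2 * (2 * a) * b ≡ 4 * (a * b)
  regroup₂ = solve-∀

mainTheorem3 : (G : Graph) (p : ℕ) → Prime p → 3 ≤ p →
    (L : List (SubgraphData G)) → Unique L →
    (∀ H → (H ∈ L) ⇔ IsCycleOfLength G p H) →
    (p * length L) ^ 2 ≤ 2 ^ (p ∸ 2) * numEdges G ^ p
mainTheorem3 G p _ 3≤p@(s≤s (s≤s (s≤s {n = q} _))) L L-unique L⇔cycles =
  halve-square-bound (p * length L) (numEdges G) (suc q) (begin
    2 * (p * length L) * (2 * (p * length L))             ≡⟨ cong (λ x → x * x) (reorder p (length L)) ⟩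
    length L * (2 * p) * (length L * (2 * p))             ≤⟨ *-mono-≤ cycles≤trace cycles≤trace ⟩
    closedWalks (suc (suc q)) * closedWalks (suc (suc q)) ≤⟨ closedWalks²≤ (suc q) ⟩
    ‖ adjacency G ‖² ^ p                                  ≡⟨ cong (_^ p) (‖adjacency‖²≡2E G) ⟩
    (2 * numEdges G) ^ p                                  ∎)
  where
  open ≤-Reasoning
  open Walks (adjacency G)
  reorder : ∀ p c → 2 * (p * c) ≡ c * (2 * p)
  reorder = solve-∀
  cycles≤trace : length L * (2 * p) ≤ closedWalks (suc (suc q))
  cycles≤trace = cycles≤closedWalks G 3≤p L-unique (All.tabulate (to (L⇔cycles _)))
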